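{- Let $1\le k\le n$ and let $f:\{0,1\}^n\to\{0,1\}$ be the $k$-of-$n$ function. Then $\Gamma(f)=k(n-k+1)$.
   Context: The $k$-of-$n$ function outputs $1$ iff at least $k$ of its $n$ input bits are $1$. A partial assignment is $b\in\{0,1,*\}^n$; $a\succeq b$ means $a_i=b_i$ whenever $b_i\ne *$. $b$ is a $0$-certificate (resp. $1$-certificate) of $f$ if $f(a)=0$ (resp. $1$) for all $a\in\{0,1\}^n$ with $a\succeq b$; a certificate is a $0$- or $1$-certificate; $b$ contains a certificate if $b\succeq c$ for some certificate $c$. For $b_i=*$, $b_{x_i\leftarrow\ell}$ is $b$ with coordinate $i$ set to $\ell\in\{0,1\}$. $g:\{0,1,*\}^n\to\mathbb{Z}_{\ge0}$ is monotone if $g(b_{x_i\leftarrow\ell})\ge g(b)$ whenever $b_i=*$, and submodular if $g(b_{x_i\leftarrow\ell})-g(b)\ge g(b'_{x_i\leftarrow\ell})-g(b')$ whenever $b'\succeq b$, $b_i=b'_i=*$. A goal function for $f$ is a monotone submodular $g$ with an integer $Q\ge0$ (its goal value) such that $g(b)=Q$ for all $b\in\{0,1\}^n$ and $g(b)=Q$ iff $b$ contains a certificate of $f$. $\Gamma(f)$ is the minimum goal value of a goal function for $f$. -}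

module Defs where

open import Data.Nat using (ℕ; zero; suc; _+_; _*_; _∸_; _≤_; _≤ᵇ_)
open import Data.Bool using (Bool; true; false; if_then_else_)
open import Data.Fin using (Fin; _≟_)
import Data.Fin as Fin
open import Data.Product using (Σ; _×_; _,_)
open import Data.Sum using (_⊎_)
open import Relation.Binary.PropositionalEquality using (_≡_; _≢_)
open import Relation.Nullary using (does)
open import Function.Bundles using (_⇔_)

data Val : Set where
  v0 v1 ⋆ : Val

embed : Bool → Val
embed false = v0
embed true  = v1

Partial : ℕ → Set
Partial n = Fin n → Val

Assignment : ℕ → Set
Assignment n = Fin n → Bool

toPartial : ∀ {n} → Assignment n → Partial n
toPartial a i = embed (a i)

_⪰_ : ∀ {n} → Partial n → Partial n → Set
a ⪰ b = ∀ i → b i ≢ ⋆ → a i ≡ b i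

countOnes : ∀ {n} → Assignment n → ℕ
countOnes {zero}  a = 0
countOnes {suc n} a = (if a Fin.zero then 1 else 0) + countOnes (λ i → a (Fin.suc i))

kOfN : (k n : ℕ) → Assignment n → Bool
kOfN k n a = k ≤ᵇ countOnes a

IsCertificate : ∀ {n} → (Assignment n → Bool) → Bool → Partial n → Set
IsCertificate f ℓ b = ∀ (a : Assignment _) → toPartial a ⪰ b → f a ≡ ℓ

ContainsCertificate : ∀ {n} → (Assignment n → Bool) → Partial n → Set
ContainsCertificate {n} f b =
  Σ (Partial n) λ c → (b ⪰ c) × (IsCertificate f false c ⊎ IsCertificate f true c)

set : ∀ {n} → Partial n → Fin n → Bool → Partial n
set b i ℓ j = if does (j ≟ i) then embed ℓ else b j

Monotone : ∀ {n} → (Partial n → ℕ) → Set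
Monotone {n} g = ∀ (b : Partial n) i ℓ → b i ≡ ⋆ → g b ≤ g (set b i ℓ)

-- g(b_{x_i←ℓ}) - g(b) ≥ g(b'_{x_i←ℓ}) - g(b'), written additively (integer differences)
Submodular : ∀ {n} → (Partial n → ℕ) → Set
Submodular {n} g = ∀ (b b' : Partial n) i ℓ → b' ⪰ b → b i ≡ ⋆ → b' i ≡ ⋆ →
  g (set b' i ℓ) + g b ≤ g (set b i ℓ) + g b'

record GoalFunction {n : ℕ} (f : Assignment n → Bool) : Set where
  field
    g          : Partial n → ℕ
    Q          : ℕ
    monotone   : Monotone g
    submodular : Submodular g
    full       : ∀ (a : Assignment n) → g (toPartial a) ≡ Q
    goal⇔cert  : ∀ (b : Partial n) → (g b ≡ Q) ⇔ ContainsCertificate f b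

ΓEquals : ∀ {n} → (Assignment n → Bool) → ℕ → Set
ΓEquals f m = (Σ (GoalFunction f) λ G → GoalFunction.Q G ≡ m)
            × (∀ (G : GoalFunction f) → m ≤ GoalFunction.Q G)

-- Let need₁ b = k − #ones(b) and need₀ b = (n − k + 1) − #zeros(b); b contains a
-- certificate of the k-of-n function exactly when one of them vanishes.
--
-- Upper bound: g = k(n − k + 1) − need₁·need₀ is a goal function. Fixing a coordinate
-- to ℓ lowers need_ℓ by one, so the product drops by need_¬ℓ, which can only shrink
-- as more coordinates get fixed: that is submodularity.
--
-- Lower bound: let g be any goal function with goal value Q. By submodularity the gain
-- of fixing x can only shrink if other coordinates are fixed to the same value first,
-- and after enough of them, fixing x completes a certificate and gains Q − g. Applied
-- to zeros, each zero fixed in an unsettled b gains at least 1, so Q − g b ≥ need₀ b;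
-- applied to ones, each one fixed then gains at least need₀ b, so
-- Q − g b ≥ need₁ b · need₀ b. At the empty assignment this is k(n − k + 1).

module Submission where

open import Defs
open import Data.Nat
  using (ℕ; zero; suc; _+_; _*_; _∸_; _≤_; _<_; _≤?_; z≤n; s≤s; pred; NonZero; >-nonZero)
open import Data.Nat.Properties
open import Data.Bool using (Bool; true; false; not)
open import Data.Bool.Properties using (not-¬)
import Data.Fin as Fin
open import Data.Product using (∃; _×_; _,_; map)
open import Data.Sum using (inj₁; inj₂; [_,_]′)
open import Data.Empty using (⊥)
open import Function using (id)
open import Relation.Binary.PropositionalEquality
open import Relation.Nullary using (¬_; contradiction)
open import Relation.Nullary.Decidable using (dec-true; dec-false)
open import Function.Bundles using (_⇔_; mk⇔; Equivalence)
open import Algebra.Properties.CommutativeSemigroup +-commutativeSemigroup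
  using (x∙yz≈y∙xz; xy∙z≈xz∙y; xy∙z≈y∙xz; interchange)

embed≢⋆ : ∀ ℓ → embed ℓ ≢ ⋆
embed≢⋆ false ()
embed≢⋆ true  ()

set-self : ∀ {n} (b : Partial n) x ℓ → set b x ℓ x ≡ embed ℓ
set-self b x ℓ rewrite dec-true (x Fin.≟ x) refl = refl

set-other : ∀ {n} (b : Partial n) x ℓ {y} → y ≢ x → set b x ℓ y ≡ b y
set-other b x ℓ {y} y≢x rewrite dec-false (y Fin.≟ x) y≢x = refl

⋆-in-set : ∀ {n} (b : Partial n) x ℓ {y} → set b x ℓ y ≡ ⋆ → y ≢ x × b y ≡ ⋆
⋆-in-set b x ℓ {y} eq = y≢x , trans (sym (set-other b x ℓ y≢x)) eq
  where
  y≢x : y ≢ x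
  y≢x refl = embed≢⋆ ℓ (trans (sym (set-self b x ℓ)) eq)

set-⪰ : ∀ {n} (b : Partial n) x ℓ → b x ≡ ⋆ → set b x ℓ ⪰ b
set-⪰ b x ℓ bx i bi≢⋆ = set-other b x ℓ λ { refl → bi≢⋆ bx }

⪰-trans : ∀ {n} {a b c : Partial n} → a ⪰ b → b ⪰ c → a ⪰ c
⪰-trans a⪰b b⪰c i ci≢⋆ =
  trans (a⪰b i λ bi≡⋆ → ci≢⋆ (trans (sym (b⪰c i ci≢⋆)) bi≡⋆)) (b⪰c i ci≢⋆)

hits : Bool → Val → ℕ
hits ℓ     ⋆  = 0
hits true  v1 = 1
hits false v0 = 1
hits _     _  = 0

count : ∀ {n} → Bool → Partial n → ℕ
count {zero}  ℓ b = 0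
count {suc n} ℓ b = hits ℓ (b Fin.zero) + count ℓ (λ i → b (Fin.suc i))

count-set : ∀ {n} ℓ′ (b : Partial n) x ℓ → b x ≡ ⋆ →
            count ℓ′ (set b x ℓ) ≡ hits ℓ′ (embed ℓ) + count ℓ′ b
count-set ℓ′ b Fin.zero    ℓ bx rewrite bx = refl
count-set ℓ′ b (Fin.suc x) ℓ bx =
  trans (cong (hits ℓ′ (b Fin.zero) +_) (count-set ℓ′ (λ i → b (Fin.suc i)) x ℓ bx))
        (x∙yz≈y∙xz (hits ℓ′ (b Fin.zero)) (hits ℓ′ (embed ℓ)) _)

count-mono : ∀ {n} ℓ {b c : Partial n} → c ⪰ b → count ℓ b ≤ count ℓ c
count-mono {zero}  ℓ c⪰b = z≤n
count-mono {suc n} ℓ {b} {c} c⪰b =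
  +-mono-≤ (head (b Fin.zero) (c⪰b Fin.zero)) (count-mono ℓ (λ i → c⪰b (Fin.suc i)))
  where
  head : ∀ u {v} → (u ≢ ⋆ → v ≡ u) → hits ℓ u ≤ hits ℓ v
  head ⋆  _   = z≤n
  head v0 v≡u = ≤-reflexive (cong (hits ℓ) (sym (v≡u λ ())))
  head v1 v≡u = ≤-reflexive (cong (hits ℓ) (sym (v≡u λ ())))

count-⋆ : ∀ {n} ℓ → count {n} ℓ (λ _ → ⋆) ≡ 0
count-⋆ {zero}  ℓ = refl
count-⋆ {suc n} ℓ = count-⋆ {n} ℓ

countOnes≡count : ∀ {n} (a : Assignment n) → countOnes a ≡ count true (toPartial a)
countOnes≡count {zero}  a = refl
countOnes≡count {suc n} a with a Fin.zero
... | false = countOnes≡count (λ i → a (Fin.suc i))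
... | true  = cong suc (countOnes≡count (λ i → a (Fin.suc i)))

countOnes+zeros≡n : ∀ {n} (a : Assignment n) → countOnes a + count false (toPartial a) ≡ n
countOnes+zeros≡n {zero}  a = refl
countOnes+zeros≡n {suc n} a with a Fin.zero
... | false = trans (+-suc _ _) (cong suc (countOnes+zeros≡n (λ i → a (Fin.suc i))))
... | true  = cong suc (countOnes+zeros≡n (λ i → a (Fin.suc i)))

count+count<n⇒⋆ : ∀ {n} (b : Partial n) → count true b + count false b < n → ∃ λ x → b x ≡ ⋆
count+count<n⇒⋆ {suc n} b fixed<1+n with b Fin.zero in b₀
... | ⋆  = Fin.zero , b₀
... | v0 = map Fin.suc id (count+count<n⇒⋆ _ (≤-pred (subst (_< suc n) (+-suc _ _) fixed<1+n)))
... | v1 = map Fin.suc id (count+count<n⇒⋆ _ (≤-pred fixed<1+n))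

fillVal : Bool → Val → Bool
fillVal ℓ v0 = false
fillVal ℓ v1 = true
fillVal ℓ ⋆  = ℓ

fill : ∀ {n} → Bool → Partial n → Assignment n
fill ℓ b i = fillVal ℓ (b i)

fill-⪰ : ∀ {n} ℓ (b : Partial n) → toPartial (fill ℓ b) ⪰ b
fill-⪰ ℓ b i with b i
... | v0 = λ _ → refl
... | v1 = λ _ → refl
... | ⋆  = λ ⋆≢⋆ → contradiction refl ⋆≢⋆

count-fill : ∀ {n} ℓ (b : Partial n) → count (not ℓ) (toPartial (fill ℓ b)) ≡ count (not ℓ) b
count-fill {zero}  ℓ b = refl
count-fill {suc n} ℓ b =
  cong₂ _+_ (head ℓ (b Fin.zero)) (count-fill ℓ (λ i → b (Fin.suc i)))
  where
  head : ∀ ℓ v → hits (not ℓ) (embed (fillVal ℓ v)) ≡ hits (not ℓ) v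
  head true  v0 = refl
  head true  v1 = refl
  head true  ⋆  = refl
  head false v0 = refl
  head false v1 = refl
  head false ⋆  = refl

pred[m]*n+o*p≤pred[o]*p+m*n : ∀ m n o p → o ≤ m → p ≤ n → pred m * n + o * p ≤ pred o * p + m * n
pred[m]*n+o*p≤pred[o]*p+m*n m n zero p _ _ = begin
  pred m * n + 0 ≡⟨ +-identityʳ _ ⟩
  pred m * n     ≤⟨ *-monoˡ-≤ n (pred[n]≤n {m}) ⟩
  m * n          ∎
  where open ≤-Reasoning
pred[m]*n+o*p≤pred[o]*p+m*n (suc m) n (suc o) p _ p≤n = begin
  m * n + (p + o * p) ≡⟨ x∙yz≈y∙xz (m * n) p (o * p) ⟩
  p + (m * n + o * p) ≡⟨ cong (p +_) (+-comm (m * n) (o * p)) ⟩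
  p + (o * p + m * n) ≤⟨ +-monoˡ-≤ _ p≤n ⟩
  n + (o * p + m * n) ≡⟨ x∙yz≈y∙xz n (o * p) (m * n) ⟩
  o * p + (n + m * n) ∎
  where open ≤-Reasoning

∸-exchange : ∀ q {a b c d} → a ≤ q → b ≤ q → c ≤ q → d ≤ q →
             c + d ≤ a + b → (q ∸ a) + (q ∸ b) ≤ (q ∸ c) + (q ∸ d)
∸-exchange q {a} {b} {c} {d} a≤q b≤q c≤q d≤q c+d≤a+b = +-cancelʳ-≤ (a + b) _ _ (begin
  (q ∸ a) + (q ∸ b) + (a + b) ≡⟨ interchange (q ∸ a) (q ∸ b) a b ⟩
  (q ∸ a + a) + (q ∸ b + b)   ≡⟨ cong₂ _+_ (m∸n+n≡m a≤q) (m∸n+n≡m b≤q) ⟩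
  q + q                       ≡⟨ cong₂ _+_ (m∸n+n≡m c≤q) (m∸n+n≡m d≤q) ⟨
  (q ∸ c + c) + (q ∸ d + d)   ≡⟨ interchange (q ∸ c) (q ∸ d) c d ⟨
  (q ∸ c) + (q ∸ d) + (c + d) ≤⟨ +-monoʳ-≤ ((q ∸ c) + (q ∸ d)) c+d≤a+b ⟩
  (q ∸ c) + (q ∸ d) + (a + b) ∎)
  where open ≤-Reasoning

module KOfN {k n : ℕ} (k≤n : k ≤ n) where

  -- the number of coordinates fixed to ℓ that forces the value ℓ
  threshold : Bool → ℕ
  threshold true  = k
  threshold false = n ∸ k + 1

  need : Bool → Partial n → ℕ
  need ℓ b = threshold ℓ ∸ count ℓ b

  threshold+threshold≡1+n : ∀ ℓ → threshold ℓ + threshold (not ℓ) ≡ suc n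
  threshold+threshold≡1+n true  = begin
    k + (n ∸ k + 1) ≡⟨ cong (k +_) (+-comm (n ∸ k) 1) ⟩
    k + suc (n ∸ k) ≡⟨ +-suc k (n ∸ k) ⟩
    suc (k + (n ∸ k)) ≡⟨ cong suc (m+[n∸m]≡n k≤n) ⟩
    suc n ∎
    where open ≡-Reasoning
  threshold+threshold≡1+n false = trans (+-comm (n ∸ k + 1) k) (threshold+threshold≡1+n true)

  need-set-self : ∀ ℓ (b : Partial n) x → b x ≡ ⋆ → need ℓ (set b x ℓ) ≡ pred (need ℓ b)
  need-set-self ℓ b x bx = begin
    threshold ℓ ∸ count ℓ (set b x ℓ)
      ≡⟨ cong (threshold ℓ ∸_) (count-set ℓ b x ℓ bx) ⟩
    threshold ℓ ∸ (hits ℓ (embed ℓ) + count ℓ b)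
      ≡⟨ cong (λ h → threshold ℓ ∸ (h + count ℓ b)) (hits-self ℓ) ⟩
    threshold ℓ ∸ suc (count ℓ b)
      ≡⟨ pred[m∸n]≡m∸[1+n] (threshold ℓ) (count ℓ b) ⟨
    pred (threshold ℓ ∸ count ℓ b) ∎
    where
    open ≡-Reasoning
    hits-self : ∀ ℓ → hits ℓ (embed ℓ) ≡ 1
    hits-self true  = refl
    hits-self false = refl

  need-set-self-suc : ∀ ℓ (b : Partial n) x {s} → b x ≡ ⋆ → need ℓ b ≡ suc s →
                      need ℓ (set b x ℓ) ≡ s
  need-set-self-suc ℓ b x bx e = trans (need-set-self ℓ b x bx) (cong pred e)

  need-set-other : ∀ ℓ (b : Partial n) x → b x ≡ ⋆ → need (not ℓ) (set b x ℓ) ≡ need (not ℓ) b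
  need-set-other ℓ b x bx =
    cong (threshold (not ℓ) ∸_)
         (trans (count-set (not ℓ) b x ℓ bx) (cong (_+ count (not ℓ) b) (hits-other ℓ)))
    where
    hits-other : ∀ ℓ → hits (not ℓ) (embed ℓ) ≡ 0
    hits-other true  = refl
    hits-other false = refl

  need-antitone : ∀ ℓ {b b′ : Partial n} → b′ ⪰ b → need ℓ b′ ≤ need ℓ b
  need-antitone ℓ b′⪰b = ∸-monoʳ-≤ (threshold ℓ) (count-mono ℓ b′⪰b)

  need≡suc⇒count< : ∀ ℓ {b : Partial n} {s} → need ℓ b ≡ suc s → count ℓ b < threshold ℓ
  need≡suc⇒count< ℓ eq = m∸n≢0⇒n<m λ eq₀ → contradiction (trans (sym eq) eq₀) λ ()

  unsettled⇒⋆ : ∀ ℓ (b : Partial n) {s r} → need ℓ b ≡ suc s → need (not ℓ) b ≡ suc r →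
                ∃ λ x → b x ≡ ⋆
  unsettled⇒⋆ false b e₀ e₁ = unsettled⇒⋆ true b e₁ e₀
  unsettled⇒⋆ true  b e₁ e₀ = count+count<n⇒⋆ b (≤-pred (begin
    suc (suc (count true b + count false b)) ≡⟨ cong suc (+-suc (count true b) (count false b)) ⟨
    suc (count true b) + suc (count false b)
      ≤⟨ +-mono-≤ (need≡suc⇒count< true e₁) (need≡suc⇒count< false e₀) ⟩
    k + (n ∸ k + 1)                         ≡⟨ threshold+threshold≡1+n true ⟩
    suc n                                   ∎))
    where open ≤-Reasoning

  f : Assignment n → Bool
  f = kOfN k n

  need≡0⇒certificate : ∀ ℓ (b : Partial n) → need ℓ b ≡ 0 → IsCertificate f ℓ b
  need≡0⇒certificate true  b e a a⪰b = dec-true (k ≤? countOnes a) (begin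
    k                        ≤⟨ m∸n≡0⇒m≤n e ⟩
    count true b             ≤⟨ count-mono true a⪰b ⟩
    count true (toPartial a) ≡⟨ countOnes≡count a ⟨
    countOnes a              ∎)
    where open ≤-Reasoning
  need≡0⇒certificate false b e a a⪰b =
    dec-false (k ≤? countOnes a) (<⇒≱ (+-cancelʳ-≤ (n ∸ k + 1) _ _ (begin
    suc (countOnes a) + (n ∸ k + 1)
      ≤⟨ s≤s (+-monoʳ-≤ (countOnes a) (≤-trans (m∸n≡0⇒m≤n e) (count-mono false a⪰b))) ⟩
    suc (countOnes a + count false (toPartial a)) ≡⟨ cong suc (countOnes+zeros≡n a) ⟩
    suc n                                ≡⟨ threshold+threshold≡1+n true ⟨
    k + (n ∸ k + 1)                      ∎)))
    where open ≤-Reasoning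

  need≡0⇒containsCertificate : ∀ ℓ (b : Partial n) → need ℓ b ≡ 0 → ContainsCertificate f b
  need≡0⇒containsCertificate true  b e = b , (λ _ _ → refl) , inj₂ (need≡0⇒certificate true b e)
  need≡0⇒containsCertificate false b e = b , (λ _ _ → refl) , inj₁ (need≡0⇒certificate false b e)

  kOfN-fill : ∀ ℓ (b : Partial n) {s r} → need true b ≡ suc s → need false b ≡ suc r →
              f (fill ℓ b) ≡ ℓ
  kOfN-fill true  b e₁ e₀ =
    dec-true (k ≤? countOnes a) (+-cancelʳ-≤ (count false b) _ _ (≤-pred (begin
    suc (k + count false b)       ≡⟨ +-suc k (count false b) ⟨
    k + suc (count false b)       ≤⟨ +-monoʳ-≤ k (need≡suc⇒count< false e₀) ⟩
    k + (n ∸ k + 1)               ≡⟨ threshold+threshold≡1+n true ⟩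
    suc n                         ≡⟨ cong suc (countOnes+zeros≡n a) ⟨
    suc (countOnes a + count false (toPartial a))
      ≡⟨ cong (λ z → suc (countOnes a + z)) (count-fill true b) ⟩
    suc (countOnes a + count false b) ∎)))
    where
    open ≤-Reasoning
    a = fill true b
  kOfN-fill false b e₁ e₀ = dec-false (k ≤? countOnes a) (<⇒≱ (begin-strict
    countOnes a              ≡⟨ countOnes≡count a ⟩
    count true (toPartial a) ≡⟨ count-fill false b ⟩
    count true b             <⟨ need≡suc⇒count< true e₁ ⟩
    k                        ∎))
    where
    open ≤-Reasoning
    a = fill false b

  unsettled⇒¬containsCertificate : ∀ (b : Partial n) {s r} →
    need true b ≡ suc s → need false b ≡ suc r → ¬ ContainsCertificate f b
  unsettled⇒¬containsCertificate b e₁ e₀ (c , b⪰c , cert) = [ refute false , refute true ]′ cert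
    where
    refute : ∀ ℓ → IsCertificate f ℓ c → ⊥
    refute ℓ cert = not-¬ refl (trans (sym (cert (fill (not ℓ) b) (⪰-trans (fill-⪰ (not ℓ) b) b⪰c)))
                                       (kOfN-fill (not ℓ) b e₁ e₀))

  data Status (b : Partial n) : Set where
    settled   : ∀ ℓ → need ℓ b ≡ 0 → Status b
    unsettled : ∀ {s r} → need true b ≡ suc s → need false b ≡ suc r → Status b

  status : ∀ b → Status b
  status b with need true b in e₁ | need false b in e₀
  ... | zero  | _     = settled true e₁
  ... | suc _ | zero  = settled false e₀
  ... | suc _ | suc _ = unsettled e₁ e₀

module UpperBound {k n : ℕ} (k≤n : k ≤ n) where
  open KOfN k≤n

  Q : ℕ
  Q = k * (n ∸ k + 1)

  residual : Partial n → ℕ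
  residual b = need true b * need false b

  g : Partial n → ℕ
  g b = Q ∸ residual b

  residual≤Q : ∀ b → residual b ≤ Q
  residual≤Q b = *-mono-≤ (m∸n≤m k (count true b)) (m∸n≤m (n ∸ k + 1) (count false b))

  residual-flip : ∀ ℓ b → residual b ≡ need ℓ b * need (not ℓ) b
  residual-flip true  b = refl
  residual-flip false b = *-comm (need true b) (need false b)

  residual-antitone : ∀ {b b′} → b′ ⪰ b → residual b′ ≤ residual b
  residual-antitone b′⪰b = *-mono-≤ (need-antitone true b′⪰b) (need-antitone false b′⪰b)

  residual-set : ∀ ℓ b x → b x ≡ ⋆ → residual (set b x ℓ) ≡ pred (need ℓ b) * need (not ℓ) b
  residual-set ℓ b x bx = trans (residual-flip ℓ (set b x ℓ))
                                (cong₂ _*_ (need-set-self ℓ b x bx) (need-set-other ℓ b x bx))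

  residual-exchange : ∀ b b′ x ℓ → b′ ⪰ b → b x ≡ ⋆ → b′ x ≡ ⋆ →
                      residual (set b x ℓ) + residual b′ ≤ residual (set b′ x ℓ) + residual b
  residual-exchange b b′ x ℓ b′⪰b bx b′x = begin
    residual (set b x ℓ) + residual b′
      ≡⟨ cong₂ _+_ (residual-set ℓ b x bx) (residual-flip ℓ b′) ⟩
    pred (need ℓ b) * need (not ℓ) b + need ℓ b′ * need (not ℓ) b′
      ≤⟨ pred[m]*n+o*p≤pred[o]*p+m*n _ _ _ _ (need-antitone ℓ b′⪰b) (need-antitone (not ℓ) b′⪰b) ⟩
    pred (need ℓ b′) * need (not ℓ) b′ + need ℓ b * need (not ℓ) b
      ≡⟨ cong₂ _+_ (residual-set ℓ b′ x b′x) (residual-flip ℓ b) ⟨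
    residual (set b′ x ℓ) + residual b ∎
    where open ≤-Reasoning

  residual-settled : ∀ ℓ b → need ℓ b ≡ 0 → residual b ≡ 0
  residual-settled ℓ b e = trans (residual-flip ℓ b) (cong (_* need (not ℓ) b) e)

  g-monotone : Monotone g
  g-monotone b x ℓ bx = ∸-monoʳ-≤ Q (residual-antitone (set-⪰ b x ℓ bx))

  g-submodular : Submodular g
  g-submodular b b′ x ℓ b′⪰b bx b′x =
    ∸-exchange Q (residual≤Q _) (residual≤Q _) (residual≤Q _) (residual≤Q _)
               (residual-exchange b b′ x ℓ b′⪰b bx b′x)

  g-full : ∀ a → g (toPartial a) ≡ Q
  g-full a with status (toPartial a)
  ... | settled ℓ e     = cong (Q ∸_) (residual-settled ℓ _ e)
  ... | unsettled e₁ e₀ with unsettled⇒⋆ true (toPartial a) e₁ e₀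
  ...   | x , ax≡⋆ = contradiction ax≡⋆ (embed≢⋆ (a x))

  g-goal⇔certificate : ∀ b → (g b ≡ Q) ⇔ ContainsCertificate f b
  g-goal⇔certificate b with status b
  ... | settled ℓ e = mk⇔ (λ _ → need≡0⇒containsCertificate ℓ b e)
                            (λ _ → cong (Q ∸_) (residual-settled ℓ b e))
  ... | unsettled e₁ e₀ = mk⇔ (λ g≡Q → contradiction g≡Q (<⇒≢ g<Q))
                                (λ c → contradiction c (unsettled⇒¬containsCertificate b e₁ e₀))
    where
    g<Q : g b < Q
    g<Q = ∸-monoʳ-< (subst (0 <_) (sym (cong₂ _*_ e₁ e₀)) (s≤s z≤n)) (residual≤Q b)

  goalFunction : GoalFunction f
  goalFunction = record
    { g = g ; Q = Q ; monotone = g-monotone ; submodular = g-submodular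
    ; full = g-full ; goal⇔cert = g-goal⇔certificate }

module LowerBound {k n : ℕ} (k≤n : k ≤ n) (G : GoalFunction (kOfN k n)) where
  open KOfN k≤n
  open GoalFunction G

  goal-if-settled : ∀ ℓ b → need ℓ b ≡ 0 → g b ≡ Q
  goal-if-settled ℓ b e = Equivalence.from (goal⇔cert b) (need≡0⇒containsCertificate ℓ b e)

  -- Fixing another coordinate y to ℓ first only shrinks the gain at x (submodularity);
  -- once fixing x settles b, the gain is Q − g b.
  gain-bound : ∀ ℓ c r →
    (∀ s b → need ℓ b ≡ suc s → need (not ℓ) b ≡ suc r → c + g b ≤ Q) →
    ∀ s b x → need ℓ b ≡ suc s → need (not ℓ) b ≡ suc r → b x ≡ ⋆ → c + g b ≤ g (set b x ℓ)
  gain-bound ℓ c r bound zero b x eℓ e¬ℓ bx = begin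
    c + g b        ≤⟨ bound zero b eℓ e¬ℓ ⟩
    Q              ≡⟨ goal-if-settled ℓ (set b x ℓ) (need-set-self-suc ℓ b x bx eℓ) ⟨
    g (set b x ℓ) ∎
    where open ≤-Reasoning
  gain-bound ℓ c r bound (suc s) b x eℓ e¬ℓ bx
    with unsettled⇒⋆ ℓ (set b x ℓ) (need-set-self-suc ℓ b x bx eℓ)
                                   (trans (need-set-other ℓ b x bx) e¬ℓ)
  ... | y , b₁y≡⋆ with ⋆-in-set b x ℓ b₁y≡⋆
  ... | y≢x , by = +-cancelʳ-≤ (g b₂) _ _ (begin
    c + g b + g b₂      ≡⟨ xy∙z≈xz∙y c (g b) (g b₂) ⟩
    c + g b₂ + g b      ≤⟨ +-monoˡ-≤ (g b) (gain-bound ℓ c r bound s b₂ x eℓ₂ e¬ℓ₂ b₂x) ⟩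
    g (set b₂ x ℓ) + g b ≤⟨ submodular b b₂ x ℓ (set-⪰ b y ℓ by) bx b₂x ⟩
    g (set b x ℓ) + g b₂ ∎)
    where
    open ≤-Reasoning
    b₂ = set b y ℓ
    b₂x : b₂ x ≡ ⋆
    b₂x = trans (set-other b y ℓ (≢-sym y≢x)) bx
    eℓ₂ : need ℓ b₂ ≡ suc s
    eℓ₂ = need-set-self-suc ℓ b y by eℓ
    e¬ℓ₂ : need (not ℓ) b₂ ≡ suc r
    e¬ℓ₂ = trans (need-set-other ℓ b y by) e¬ℓ

  deficit-bound : ∀ ℓ c r →
    (∀ s b x → need ℓ b ≡ suc s → need (not ℓ) b ≡ suc r → b x ≡ ⋆ → c + g b ≤ g (set b x ℓ)) →
    ∀ s b → need ℓ b ≡ suc s → need (not ℓ) b ≡ suc r → suc s * c + g b ≤ Q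
  deficit-bound ℓ c r gain s b eℓ e¬ℓ with unsettled⇒⋆ ℓ b eℓ e¬ℓ
  deficit-bound ℓ c r gain zero b eℓ e¬ℓ | x , bx = begin
    1 * c + g b   ≡⟨ cong (_+ g b) (*-identityˡ c) ⟩
    c + g b       ≤⟨ gain zero b x eℓ e¬ℓ bx ⟩
    g (set b x ℓ) ≡⟨ goal-if-settled ℓ (set b x ℓ) (need-set-self-suc ℓ b x bx eℓ) ⟩
    Q             ∎
    where open ≤-Reasoning
  deficit-bound ℓ c r gain (suc s) b eℓ e¬ℓ | x , bx = begin
    c + suc s * c + g b      ≡⟨ xy∙z≈y∙xz c (suc s * c) (g b) ⟩
    suc s * c + (c + g b)    ≤⟨ +-monoʳ-≤ (suc s * c) (gain (suc s) b x eℓ e¬ℓ bx) ⟩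
    suc s * c + g (set b x ℓ) ≤⟨ deficit-bound ℓ c r gain s (set b x ℓ)
                                  (need-set-self-suc ℓ b x bx eℓ)
                                  (trans (need-set-other ℓ b x bx) e¬ℓ) ⟩
    Q                        ∎
    where open ≤-Reasoning

  below-goal : ∀ s r b → need false b ≡ suc s → need true b ≡ suc r → suc (g b) ≤ Q
  below-goal s r b e₀ e₁ =
    ≤∧≢⇒< g≤Q λ g≡Q → unsettled⇒¬containsCertificate b e₁ e₀ (Equivalence.to (goal⇔cert b) g≡Q)
    where
    -- with zero gain, deficit-bound is just iterated monotonicity
    g≤Q : g b ≤ Q
    g≤Q = subst (λ m → m + g b ≤ Q) (*-zeroʳ (suc s))
            (deficit-bound false 0 r (λ _ b x _ _ bx → monotone b x false bx) s b e₀ e₁)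

  zero-deficit : ∀ s r b → need false b ≡ suc s → need true b ≡ suc r → suc s + g b ≤ Q
  zero-deficit s r b e₀ e₁ = subst (λ m → m + g b ≤ Q) (*-identityʳ (suc s))
    (deficit-bound false 1 r (gain-bound false 1 r λ s b → below-goal s r b) s b e₀ e₁)

  one-deficit : ∀ s r b → need true b ≡ suc s → need false b ≡ suc r → suc s * suc r + g b ≤ Q
  one-deficit s r b e₁ e₀ =
    deficit-bound true (suc r) r (gain-bound true (suc r) r λ s b e₁ e₀ → zero-deficit r s b e₀ e₁)
                  s b e₁ e₀

  goal-lower-bound : .{{NonZero k}} → k * (n ∸ k + 1) ≤ Q
  goal-lower-bound = begin
    k * (n ∸ k + 1)                     ≡⟨ cong₂ _*_ (suc-pred k) (+-comm 1 (n ∸ k)) ⟨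
    suc (pred k) * suc (n ∸ k)          ≤⟨ m≤m+n _ (g unset) ⟩
    suc (pred k) * suc (n ∸ k) + g unset ≤⟨ one-deficit (pred k) (n ∸ k) unset e₁ e₀ ⟩
    Q                                   ∎
    where
    open ≤-Reasoning
    unset : Partial n
    unset _ = ⋆
    e₁ : need true unset ≡ suc (pred k)
    e₁ = trans (cong (k ∸_) (count-⋆ {n} true)) (sym (suc-pred k))
    e₀ : need false unset ≡ suc (n ∸ k)
    e₀ = trans (cong (n ∸ k + 1 ∸_) (count-⋆ {n} false)) (+-comm (n ∸ k) 1)

theorem3 : ∀ (k n : ℕ) → 1 ≤ k → k ≤ n → ΓEquals (kOfN k n) (k * (n ∸ k + 1))
theorem3 k n 1≤k k≤n = (UpperBound.goalFunction k≤n , refl)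
                     , λ G → LowerBound.goal-lower-bound k≤n G {{>-nonZero 1≤k}}
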